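{- Let $G$ be a graph of order $n\ge 2$ and let $k$ be a positive integer with $k\le \mathcal{C}(G)$. Then $\operatorname{adim}_k(G)=k$ if and only if $k\in\{1,2\}$ and $G\in\{P_2,P_3,\overline{P_2},\overline{P_3}\}$.
   Context: All graphs are finite and simple; $\overline{G}$ denotes the complement and $P_n$ the path on $n$ vertices. For a graph $G=(V,E)$, $d_{G,2}(x,y)=\min\{d_G(x,y),2\}$ with $d_G$ the shortest-path distance ($\infty$ between different components). For distinct $x,y$, $\mathcal{C}_G(x,y)=\{z\in V: d_{G,2}(x,z)\ne d_{G,2}(y,z)\}$ and $\mathcal{C}(G)=\min_{x\ne y}|\mathcal{C}_G(x,y)|$. A set $S\subseteq V$ is a $k$-adjacency generator if $|S\cap\mathcal{C}_G(x,y)|\ge k$ for all distinct $x,y$; $\operatorname{adim}_k(G)$ is the minimum cardinality of such a set (it exists exactly when $k\le\mathcal{C}(G)$). -}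

module Defs where

open import Data.Nat using (ℕ; zero; suc; _≤_)
open import Data.Nat.Base using (∣_-_∣)
import Data.Nat as ℕ
open import Data.Bool using (Bool; true; false; not; _∧_; if_then_else_)
open import Data.Fin using (Fin; toℕ)
import Data.Fin as Fin
open import Data.Fin.Subset using (Subset; ∣_∣; _∩_)
open import Data.Vec using (tabulate)
open import Relation.Binary.PropositionalEquality using (_≡_; _≢_; refl; cong; cong₂; trans) renaming (sym to sym≡)
open import Relation.Nullary using (yes; no)
open import Data.Empty using (⊥-elim)
open import Data.Bool.Properties using (∧-zeroʳ)
open import Relation.Nullary.Decidable using (⌊_⌋)

record Graph (n : ℕ) : Set where
  field
    adj   : Fin n → Fin n → Bool
    sym   : ∀ x y → adj x y ≡ adj y x
    irrefl : ∀ x → adj x x ≡ false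
open Graph public

-- d_{G,2}(x,y) = min{d_G(x,y),2}: 0 if x = y, 1 if adjacent, 2 otherwise
-- (distance ≥ 2, including ∞ between components).
d2 : ∀ {n} → Graph n → Fin n → Fin n → ℕ
d2 G x y = if ⌊ x Fin.≟ y ⌋ then 0 else (if adj G x y then 1 else 2)

C : ∀ {n} → Graph n → Fin n → Fin n → Subset n
C G x y = tabulate (λ z → not ⌊ d2 G x z ℕ.≟ d2 G y z ⌋)

IsKAdjGen : ∀ {n} → Graph n → ℕ → Subset n → Set
IsKAdjGen G k S = ∀ x y → x ≢ y → k ≤ ∣ S ∩ C G x y ∣

IsAdim : ∀ {n} → Graph n → ℕ → ℕ → Set
IsAdim {n} G k m =
  (Σ' (Subset n) (λ S → IsKAdjGen G k S × (∣ S ∣ ≡ m)))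
  × (∀ S → IsKAdjGen G k S → m ≤ ∣ S ∣)
  where
    open import Data.Product using (_×_) renaming (Σ to Σ')

record _≅_ {n m : ℕ} (G : Graph n) (H : Graph m) : Set where
  field
    to      : Fin n → Fin m
    from    : Fin m → Fin n
    from-to : ∀ x → from (to x) ≡ x
    to-from : ∀ y → to (from y) ≡ y
    adj-pres : ∀ x y → adj H (to x) (to y) ≡ adj G x y

P : (m : ℕ) → Graph m
P m = record
  { adj = λ i j → ⌊ ∣ toℕ i - toℕ j ∣ ℕ.≟ 1 ⌋
  ; sym = λ i j → Relation.Binary.PropositionalEquality.cong (λ t → ⌊ t ℕ.≟ 1 ⌋) (Data.Nat.Properties.∣-∣-comm (toℕ i) (toℕ j))
  ; irrefl = λ i → Relation.Binary.PropositionalEquality.cong (λ t → ⌊ t ℕ.≟ 1 ⌋) (Data.Nat.Properties.∣n-n∣≡0 (toℕ i))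
  }
  where
    import Data.Nat.Properties
    import Relation.Binary.PropositionalEquality

eqb-sym : ∀ {n} (x y : Fin n) → ⌊ x Fin.≟ y ⌋ ≡ ⌊ y Fin.≟ x ⌋
eqb-sym x y with x Fin.≟ y | y Fin.≟ x
... | yes _ | yes _ = refl
... | no _  | no _  = refl
... | yes p | no q  = ⊥-elim (q (sym≡ p))
... | no p  | yes q = ⊥-elim (p (sym≡ q))

eqb-refl : ∀ {n} (x : Fin n) → ⌊ x Fin.≟ x ⌋ ≡ true
eqb-refl x with x Fin.≟ x
... | yes _ = refl
... | no p  = ⊥-elim (p refl)

compl : ∀ {n} → Graph n → Graph n
compl {n} G = record
  { adj = λ x y → not (adj G x y) ∧ not ⌊ x Fin.≟ y ⌋
  ; sym = λ x y → cong₂ (λ a b → not a ∧ not b) (Graph.sym G x y) (eqb-sym x y)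
  ; irrefl = λ x → trans (cong (λ b → not (adj G x x) ∧ not b) (eqb-refl x)) (∧-zeroʳ (not (adj G x x)))
  }

-- If S is a k-adjacency generator with |S| = k, every pair x ≠ y must be distinguished by every
-- vertex of S, so each z ∈ S is resolving: x ↦ d₂(x,z) is injective. As d₂ takes only the
-- values 0, 1, 2, this forces n ≤ 3, and k = n would make every vertex resolving, which no graph
-- of order 3 allows. Among graphs of order 2 and 3, those with a resolving vertex are exactly
-- P₂, P₃ and their complements. Conversely, in these graphs every set of resolving vertices of
-- size 1 or 2 is a generator of that size, and no k-generator is smaller than k, because a single
-- pair of vertices must already be distinguished k times.
module Submission where

open import Defs hiding (sym)
open import Data.Bool using (Bool; true; false)
import Data.Bool as Bool
open import Data.Empty using (⊥-elim)
open import Data.Fin using (Fin; fromℕ<; _≟_)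
open import Data.Fin.Patterns using (0F; 1F; 2F)
open import Data.Fin.Properties using (0≢1+n; all?; any?; fromℕ<-injective; injective⇒≤)
open import Data.Fin.Subset using (Subset; Nonempty; _∈_; _∩_; ∣_∣; ⊤; ∁; ⁅_⁆; inside; outside)
open import Data.Fin.Subset.Properties
open import Data.Nat using (ℕ; suc; _≤_; _<_; z≤n; s≤s; _∸_)
import Data.Nat as ℕ
open import Data.Nat.Properties using (<⇒≱; ≤-trans; ≤-antisym)
open import Data.Product using (_×_; _,_; proj₂; ∃)
open import Data.Sum using (_⊎_; inj₁; inj₂)
open import Data.Unit using (tt)
open import Data.Vec using (_∷_; here; there)
open import Data.Vec.Properties using (lookup⇒[]=; []=⇒lookup; lookup∘tabulate)
open import Function using (_∘_)
open import Function.Bundles using (_⇔_; mk⇔)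
open import Relation.Binary.PropositionalEquality
  using (_≡_; _≢_; refl; sym; trans; cong; cong₂; subst)
open import Relation.Nullary using (Dec; yes; no; ¬_; ¬?; contradiction)
open import Relation.Nullary.Decidable using (True; False; ⌊_⌋; toWitness; toWitnessFalse; _→-dec_)

Resolving : ∀ {n} → Graph n → Fin n → Set
Resolving G v = ∀ x y → x ≢ y → d2 G x v ≢ d2 G y v

resolving? : ∀ {n} (G : Graph n) v → Dec (Resolving G v)
resolving? G v = all? λ x → all? λ y → ¬? (x ≟ y) →-dec ¬? (d2 G x v ℕ.≟ d2 G y v)

∈C⁺ : ∀ {n} (G : Graph n) x y {z} → d2 G x z ≢ d2 G y z → z ∈ C G x y
∈C⁺ G x y {z} ne = lookup⇒[]= z (C G x y) (trans (lookup∘tabulate _ z) distinguishes)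
  where
  distinguishes : Bool.not ⌊ d2 G x z ℕ.≟ d2 G y z ⌋ ≡ true
  distinguishes with d2 G x z ℕ.≟ d2 G y z
  ... | yes e = contradiction e ne
  ... | no _  = refl

∈C⁻ : ∀ {n} (G : Graph n) x y {z} → z ∈ C G x y → d2 G x z ≢ d2 G y z
∈C⁻ G x y {z} z∈C = distinguishes (trans (sym (lookup∘tabulate _ z)) ([]=⇒lookup z∈C))
  where
  distinguishes : Bool.not ⌊ d2 G x z ℕ.≟ d2 G y z ⌋ ≡ true → d2 G x z ≢ d2 G y z
  distinguishes e with d2 G x z ℕ.≟ d2 G y z
  distinguishes () | yes _
  ... | no ne = ne

d2<3 : ∀ {n} (G : Graph n) x y → d2 G x y < 3
d2<3 G x y with ⌊ x ≟ y ⌋ | adj G x y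
... | true  | _     = s≤s z≤n
... | false | true  = s≤s (s≤s z≤n)
... | false | false = s≤s (s≤s (s≤s z≤n))

resolving⇒order≤3 : ∀ {n} (G : Graph n) {v} → Resolving G v → n ≤ 3
resolving⇒order≤3 G {v} res = injective⇒≤ injective
  where
  injective : ∀ {a b} → fromℕ< (d2<3 G a v) ≡ fromℕ< (d2<3 G b v) → a ≡ b
  injective {a} {b} e with a ≟ b
  ... | yes a≡b = a≡b
  ... | no a≢b  = contradiction (fromℕ<-injective _ _ _ _ e) (res a b a≢b)

tight-generator⇒resolving : ∀ {n} (G : Graph n) {k S} → IsKAdjGen G k S → ∣ S ∣ ≡ k
  → ∀ {v} → v ∈ S → Resolving G v
tight-generator⇒resolving G {k} {S} gen ∣S∣≡k {v} v∈S x y x≢y with v ∈? C G x y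
... | yes v∈C = ∈C⁻ G x y v∈C
... | no  v∉C = contradiction (subst (_≤ ∣ S ∩ C G x y ∣) (sym ∣S∣≡k) (gen x y x≢y)) (<⇒≱ S∩C<S)
  where
  S∩C<S : ∣ S ∩ C G x y ∣ < ∣ S ∣
  S∩C<S = p⊂q⇒∣p∣<∣q∣ (p∩q⊆p S _ , v , v∈S , v∉C ∘ proj₂ ∘ x∈p∩q⁻ S _)

resolving-set⇒IsAdim : ∀ {n} (G : Graph n) {x y : Fin n} → x ≢ y → (S : Subset n)
  → (∀ {z} → z ∈ S → Resolving G z) → IsAdim G ∣ S ∣ ∣ S ∣
resolving-set⇒IsAdim G {x} {y} x≢y S res = (S , generator , refl) , minimal
  where
  generator : IsKAdjGen G ∣ S ∣ S
  generator a b a≢b = p⊆q⇒∣p∣≤∣q∣ λ z∈S → x∈p∩q⁺ (z∈S , ∈C⁺ G a b (res z∈S a b a≢b))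

  minimal : ∀ T → IsKAdjGen G ∣ S ∣ T → ∣ S ∣ ≤ ∣ T ∣
  minimal T gen = ≤-trans (gen x y x≢y) (∣p∩q∣≤∣p∣ T _)

1≤∣p∣⇒Nonempty : ∀ {n} (p : Subset n) → 1 ≤ ∣ p ∣ → Nonempty p
1≤∣p∣⇒Nonempty (inside ∷ p)  _ = 0F , here
1≤∣p∣⇒Nonempty (outside ∷ p) h with 1≤∣p∣⇒Nonempty p h
... | x , x∈p = Fin.suc x , there x∈p

≅-sym : ∀ {n m} {G : Graph n} {H : Graph m} → G ≅ H → H ≅ G
≅-sym {H = H} φ = record
  { to = from ; from = to ; from-to = to-from ; to-from = from-to
  ; adj-pres = λ x y → trans (sym (adj-pres (from x) (from y)))
                             (cong₂ (adj H) (to-from x) (to-from y)) }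
  where open _≅_ φ

≅-trans : ∀ {n m l} {G : Graph n} {H : Graph m} {K : Graph l} → G ≅ H → H ≅ K → G ≅ K
≅-trans φ ψ = record
  { to = ψ.to ∘ φ.to ; from = φ.from ∘ ψ.from
  ; from-to = λ x → trans (cong φ.from (ψ.from-to (φ.to x))) (φ.from-to x)
  ; to-from = λ y → trans (cong ψ.to (φ.to-from (ψ.from y))) (ψ.to-from y)
  ; adj-pres = λ x y → trans (ψ.adj-pres (φ.to x) (φ.to y)) (φ.adj-pres x y) }
  where
  module φ = _≅_ φ
  module ψ = _≅_ ψ

module Iso {n m} {G : Graph n} {H : Graph m} (φ : G ≅ H) where
  open _≅_ φ

  to-injective : ∀ {a b} → to a ≡ to b → a ≡ b
  to-injective {a} {b} e = trans (sym (from-to a)) (trans (cong from e) (from-to b))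

  from-injective : ∀ {a b} → from a ≡ from b → a ≡ b
  from-injective {a} {b} e = trans (sym (to-from a)) (trans (cong to e) (to-from b))

  d2-pres : ∀ x y → d2 H (to x) (to y) ≡ d2 G x y
  d2-pres x y with x ≟ y | to x ≟ to y
  ... | yes _   | yes _     = refl
  ... | yes x≡y | no tx≢ty  = contradiction (cong to x≡y) tx≢ty
  ... | no x≢y  | yes tx≡ty = contradiction (to-injective tx≡ty) x≢y
  ... | no _    | no _      = cong (λ b → Bool.if b then 1 else 2) (adj-pres x y)

  resolving-reflect : ∀ z → Resolving H (to z) → Resolving G z
  resolving-reflect z res a b a≢b e =
    res (to a) (to b) (a≢b ∘ to-injective) (trans (d2-pres a z) (trans e (sym (d2-pres b z))))

  order-≡ : n ≡ m
  order-≡ = ≤-antisym (injective⇒≤ to-injective) (injective⇒≤ from-injective)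

  to-≢ : ∀ {z y} → z ≢ from y → to z ≢ y
  to-≢ {z} z≢fy tz≡y = z≢fy (trans (sym (from-to z)) (cong from tz≡y))

involution⇒≅ : ∀ {n} (G H : Graph n) (t : Fin n → Fin n) → (∀ x → t (t x) ≡ x)
  → (∀ x y → adj H (t x) (t y) ≡ adj G x y) → G ≅ H
involution⇒≅ G H t inv pres =
  record { to = t ; from = t ; from-to = inv ; to-from = inv ; adj-pres = pres }

SmallPathOrComplement : ∀ {n} → Graph n → Set
SmallPathOrComplement G = G ≅ P 2 ⊎ G ≅ P 3 ⊎ G ≅ compl (P 2) ⊎ G ≅ compl (P 3)

SmallPathOrComplement-≅ : ∀ {n m} {G : Graph n} {H : Graph m}
  → G ≅ H → SmallPathOrComplement H → SmallPathOrComplement G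
SmallPathOrComplement-≅ φ (inj₁ ψ)               = inj₁ (≅-trans φ ψ)
SmallPathOrComplement-≅ φ (inj₂ (inj₁ ψ))        = inj₂ (inj₁ (≅-trans φ ψ))
SmallPathOrComplement-≅ φ (inj₂ (inj₂ (inj₁ ψ))) = inj₂ (inj₂ (inj₁ (≅-trans φ ψ)))
SmallPathOrComplement-≅ φ (inj₂ (inj₂ (inj₂ ψ))) = inj₂ (inj₂ (inj₂ (≅-trans φ ψ)))

order2-≅ : (G H : Graph 2) → adj H 0F 1F ≡ adj G 0F 1F → G ≅ H
order2-≅ G H e = involution⇒≅ G H (λ x → x) (λ _ → refl) pres
  where
  pres : ∀ x y → adj H x y ≡ adj G x y
  pres 0F 0F = trans (irrefl H 0F) (sym (irrefl G 0F))
  pres 0F 1F = e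
  pres 1F 0F = trans (Graph.sym H 1F 0F) (trans e (Graph.sym G 0F 1F))
  pres 1F 1F = trans (irrefl H 1F) (sym (irrefl G 1F))

order2-classification : (G : Graph 2) → SmallPathOrComplement G
order2-classification G with adj G 0F 1F in e
... | true  = inj₁ (order2-≅ G (P 2) (sym e))
... | false = inj₂ (inj₂ (inj₁ (order2-≅ G (compl (P 2)) (sym e))))

G3 : Bool → Bool → Bool → Graph 3
G3 a b c = record { adj = adj3 ; sym = sym3 ; irrefl = irrefl3 }
  where
  adj3 : Fin 3 → Fin 3 → Bool
  adj3 0F 1F = a
  adj3 1F 0F = a
  adj3 0F 2F = b
  adj3 2F 0F = b
  adj3 1F 2F = c
  adj3 2F 1F = c
  adj3 _  _  = false

  sym3 : ∀ x y → adj3 x y ≡ adj3 y x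
  sym3 0F 0F = refl
  sym3 0F 1F = refl
  sym3 0F 2F = refl
  sym3 1F 0F = refl
  sym3 1F 1F = refl
  sym3 1F 2F = refl
  sym3 2F 0F = refl
  sym3 2F 1F = refl
  sym3 2F 2F = refl

  irrefl3 : ∀ x → adj3 x x ≡ false
  irrefl3 0F = refl
  irrefl3 1F = refl
  irrefl3 2F = refl

≅G3 : (G : Graph 3) → G ≅ G3 (adj G 0F 1F) (adj G 0F 2F) (adj G 1F 2F)
≅G3 G = involution⇒≅ G _ (λ x → x) (λ _ → refl) pres
  where
  pres : ∀ x y → adj (G3 (adj G 0F 1F) (adj G 0F 2F) (adj G 1F 2F)) x y ≡ adj G x y
  pres 0F 0F = sym (irrefl G 0F)
  pres 0F 1F = refl
  pres 0F 2F = refl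
  pres 1F 0F = Graph.sym G 0F 1F
  pres 1F 1F = sym (irrefl G 1F)
  pres 1F 2F = refl
  pres 2F 0F = Graph.sym G 0F 2F
  pres 2F 1F = Graph.sym G 1F 2F
  pres 2F 2F = sym (irrefl G 2F)

swap01 swap12 : Fin 3 → Fin 3
swap01 0F = 1F
swap01 1F = 0F
swap01 2F = 2F
swap12 0F = 0F
swap12 1F = 2F
swap12 2F = 1F

swap01-involutive : ∀ x → swap01 (swap01 x) ≡ x
swap01-involutive 0F = refl
swap01-involutive 1F = refl
swap01-involutive 2F = refl

swap12-involutive : ∀ x → swap12 (swap12 x) ≡ x
swap12-involutive 0F = refl
swap12-involutive 1F = refl
swap12-involutive 2F = refl

adj-pres? : ∀ {n} (G H : Graph n) (t : Fin n → Fin n) → Dec (∀ x y → adj H (t x) (t y) ≡ adj G x y)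
adj-pres? G H t = all? λ x → all? λ y → adj H (t x) (t y) Bool.≟ adj G x y

decided-no-resolving : ∀ {n} (G : Graph n) → False (any? (resolving? G)) → ¬ ∃ (Resolving G)
decided-no-resolving G = toWitnessFalse

decided-not-all-resolving : ∀ {n} (G : Graph n) → False (all? (resolving? G))
  → ¬ (∀ v → Resolving G v)
decided-not-all-resolving G = toWitnessFalse

decided-≅ : ∀ {n} (G H : Graph n) (t : Fin n → Fin n) → (∀ x → t (t x) ≡ x)
  → True (adj-pres? G H t) → G ≅ H
decided-≅ G H t inv pres = involution⇒≅ G H t inv (toWitness pres)

G3-classification : ∀ a b c → ∃ (Resolving (G3 a b c)) → SmallPathOrComplement (G3 a b c)
G3-classification false false false r = ⊥-elim (decided-no-resolving (G3 false false false) tt r)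
G3-classification true  true  true  r = ⊥-elim (decided-no-resolving (G3 true true true) tt r)
G3-classification true  true  false _ = inj₂ (inj₁ (decided-≅ _ _ swap01 swap01-involutive tt))
G3-classification true  false true  _ = inj₂ (inj₁ (decided-≅ _ _ (λ x → x) (λ _ → refl) tt))
G3-classification false true  true  _ = inj₂ (inj₁ (decided-≅ _ _ swap12 swap12-involutive tt))
G3-classification true  false false _ = inj₂ (inj₂ (inj₂ (decided-≅ _ _ swap12 swap12-involutive tt)))
G3-classification false true  false _ = inj₂ (inj₂ (inj₂ (decided-≅ _ _ (λ x → x) (λ _ → refl) tt)))
G3-classification false false true  _ = inj₂ (inj₂ (inj₂ (decided-≅ _ _ swap01 swap01-involutive tt)))

G3-not-all-resolving : ∀ a b c → ¬ (∀ v → Resolving (G3 a b c) v)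
G3-not-all-resolving false false false = decided-not-all-resolving (G3 false false false) tt
G3-not-all-resolving false false true  = decided-not-all-resolving (G3 false false true) tt
G3-not-all-resolving false true  false = decided-not-all-resolving (G3 false true false) tt
G3-not-all-resolving false true  true  = decided-not-all-resolving (G3 false true true) tt
G3-not-all-resolving true  false false = decided-not-all-resolving (G3 true false false) tt
G3-not-all-resolving true  false true  = decided-not-all-resolving (G3 true false true) tt
G3-not-all-resolving true  true  false = decided-not-all-resolving (G3 true true false) tt
G3-not-all-resolving true  true  true  = decided-not-all-resolving (G3 true true true) tt

order3-classification : (G : Graph 3) → ∃ (Resolving G) → SmallPathOrComplement G
order3-classification G (v , res) = SmallPathOrComplement-≅ (≅G3 G)
  (G3-classification _ _ _ (v , Iso.resolving-reflect (≅-sym (≅G3 G)) v res))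

order3-not-all-resolving : (G : Graph 3) → ¬ (∀ v → Resolving G v)
order3-not-all-resolving G all = G3-not-all-resolving _ _ _ λ v →
  Iso.resolving-reflect (≅-sym (≅G3 G)) v (all _)

all-resolving-P2 : ∀ v → Resolving (P 2) v
all-resolving-P2 = toWitness {a? = all? (resolving? (P 2))} tt

all-resolving-compl-P2 : ∀ v → Resolving (compl (P 2)) v
all-resolving-compl-P2 = toWitness {a? = all? (resolving? (compl (P 2)))} tt

ends-resolving-P3 : ∀ v → v ≢ 1F → Resolving (P 3) v
ends-resolving-P3 = toWitness {a? = all? λ v → ¬? (v ≟ 1F) →-dec resolving? (P 3) v} tt

ends-resolving-compl-P3 : ∀ v → v ≢ 1F → Resolving (compl (P 3)) v
ends-resolving-compl-P3 = toWitness {a? = all? λ v → ¬? (v ≟ 1F) →-dec resolving? (compl (P 3)) v} tt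

order2-all-resolving⇒IsAdim : (G : Graph 2) → (∀ v → Resolving G v) → ∀ k → k ≡ 1 ⊎ k ≡ 2 → IsAdim G k k
order2-all-resolving⇒IsAdim G res _ (inj₁ refl) =
  subst (λ t → IsAdim G t t) (∣⁅x⁆∣≡1 {n = 2} 0F)
    (resolving-set⇒IsAdim G {0F} {1F} (λ ()) ⁅ 0F ⁆ λ _ → res _)
order2-all-resolving⇒IsAdim G res _ (inj₂ refl) = resolving-set⇒IsAdim G {0F} {1F} (λ ()) ⊤ λ _ → res _

order3-resolving-but-one⇒IsAdim : (G : Graph 3) {u w : Fin 3} → w ≢ u → (∀ v → v ≢ u → Resolving G v)
  → ∀ k → k ≡ 1 ⊎ k ≡ 2 → IsAdim G k k
order3-resolving-but-one⇒IsAdim G {u} {w} w≢u res _ (inj₁ refl) =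
  subst (λ t → IsAdim G t t) (∣⁅x⁆∣≡1 w)
    (resolving-set⇒IsAdim G w≢u ⁅ w ⁆ λ v∈⁅w⁆ → res _ λ { refl → w≢u (sym (x∈⁅y⁆⇒x≡y w v∈⁅w⁆)) })
order3-resolving-but-one⇒IsAdim G {u} {w} w≢u res _ (inj₂ refl) =
  subst (λ t → IsAdim G t t) (trans (∣∁p∣≡n∸∣p∣ ⁅ u ⁆) (cong (3 ∸_) (∣⁅x⁆∣≡1 u)))
    (resolving-set⇒IsAdim G w≢u (∁ ⁅ u ⁆) λ v∈∁⁅u⁆ → res _ λ { refl → x∈∁p⇒x∉p v∈∁⁅u⁆ (x∈⁅x⁆ u) })

≅-all-resolving⇒IsAdim : {G H : Graph 2} → G ≅ H → (∀ v → Resolving H v)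
  → ∀ k → k ≡ 1 ⊎ k ≡ 2 → IsAdim G k k
≅-all-resolving⇒IsAdim {G} φ res = order2-all-resolving⇒IsAdim G λ v → resolving-reflect v (res _)
  where open Iso φ

≅-ends-resolving⇒IsAdim : {G H : Graph 3} → G ≅ H → (∀ v → v ≢ 1F → Resolving H v)
  → ∀ k → k ≡ 1 ⊎ k ≡ 2 → IsAdim G k k
≅-ends-resolving⇒IsAdim {G} φ res =
  order3-resolving-but-one⇒IsAdim G (0≢1+n ∘ from-injective) λ v v≢u → resolving-reflect v (res _ (to-≢ v≢u))
  where open Iso φ

SmallPathOrComplement⇒IsAdim : ∀ {n} (G : Graph n) k → k ≡ 1 ⊎ k ≡ 2
  → SmallPathOrComplement G → IsAdim G k k
SmallPathOrComplement⇒IsAdim G k k∈12 (inj₁ φ) with Iso.order-≡ φ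
... | refl = ≅-all-resolving⇒IsAdim φ all-resolving-P2 k k∈12
SmallPathOrComplement⇒IsAdim G k k∈12 (inj₂ (inj₁ φ)) with Iso.order-≡ φ
... | refl = ≅-ends-resolving⇒IsAdim φ ends-resolving-P3 k k∈12
SmallPathOrComplement⇒IsAdim G k k∈12 (inj₂ (inj₂ (inj₁ φ))) with Iso.order-≡ φ
... | refl = ≅-all-resolving⇒IsAdim φ all-resolving-compl-P2 k k∈12
SmallPathOrComplement⇒IsAdim G k k∈12 (inj₂ (inj₂ (inj₂ φ))) with Iso.order-≡ φ
... | refl = ≅-ends-resolving⇒IsAdim φ ends-resolving-compl-P3 k k∈12

small-order-classification : ∀ {n} (G : Graph n) → 2 ≤ n → n ≤ 3 → ∀ k → 1 ≤ k → k ≤ n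
  → ∃ (Resolving G) → (k ≡ n → ∀ v → Resolving G v)
  → (k ≡ 1 ⊎ k ≡ 2) × SmallPathOrComplement G
small-order-classification {2} G _ _ 1 _ _ _ _ = inj₁ refl , order2-classification G
small-order-classification {2} G _ _ 2 _ _ _ _ = inj₂ refl , order2-classification G
small-order-classification {3} G _ _ 1 _ _ r _ = inj₁ refl , order3-classification G r
small-order-classification {3} G _ _ 2 _ _ r _ = inj₂ refl , order3-classification G r
small-order-classification {3} G _ _ 3 _ _ _ all = ⊥-elim (order3-not-all-resolving G (all refl))
small-order-classification {1} G (s≤s ()) _ _ _ _ _ _
small-order-classification {2} G _ _ (suc (suc (suc _))) _ (s≤s (s≤s ())) _ _
small-order-classification {3} G _ _ (suc (suc (suc (suc _)))) _ (s≤s (s≤s (s≤s ()))) _ _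
small-order-classification {suc (suc (suc (suc _)))} G _ (s≤s (s≤s (s≤s ()))) _ _ _ _ _

IsAdim⇒SmallPathOrComplement : ∀ {n} (G : Graph n) → 2 ≤ n → ∀ k → 1 ≤ k → IsAdim G k k
  → (k ≡ 1 ⊎ k ≡ 2) × SmallPathOrComplement G
IsAdim⇒SmallPathOrComplement {n} G 2≤n k 1≤k ((S , gen , ∣S∣≡k) , _)
  with 1≤∣p∣⇒Nonempty S (subst (1 ≤_) (sym ∣S∣≡k) 1≤k)
... | v , v∈S = small-order-classification G 2≤n (resolving⇒order≤3 G (resolving v∈S)) k 1≤k
                  (subst (_≤ n) ∣S∣≡k (∣p∣≤n S)) (v , resolving v∈S) all-resolving
  where
  resolving : ∀ {u} → u ∈ S → Resolving G u
  resolving = tight-generator⇒resolving G gen ∣S∣≡k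

  all-resolving : k ≡ n → ∀ u → Resolving G u
  all-resolving refl u = resolving (subst (u ∈_) (sym (∣p∣≡n⇒p≡⊤ ∣S∣≡k)) ∈⊤)

proposition16 : ∀ {n} (G : Graph n) → 2 ≤ n → (k : ℕ) → 1 ≤ k
    → (∀ (x y : Fin n) → x ≢ y → k ≤ ∣ C G x y ∣)
    → (IsAdim G k k ⇔ ((k ≡ 1 ⊎ k ≡ 2)
        × (G ≅ P 2 ⊎ G ≅ P 3 ⊎ G ≅ compl (P 2) ⊎ G ≅ compl (P 3))))
-- The bound k ≤ 𝒞(G) only ensures that adim_k(G) is defined.
proposition16 G 2≤n k 1≤k _ =
  mk⇔ (IsAdim⇒SmallPathOrComplement G 2≤n k 1≤k)
      (λ (k∈12 , small) → SmallPathOrComplement⇒IsAdim G k k∈12 small)
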